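{- Let $k \le n$ be nonnegative integers. The number of pairs $(T,v)$, where $T$ is a rooted tree with vertex set $[n]=\{1,\dots,n\}$ and $v$ is a record of $T$ at height $k-1$, equals the number of connected endofunctions $f:[n]\to[n]$ of girth $k$.
   Context: All trees are labeled. A rooted tree on $[n]$ has vertex set $[n]$ and a distinguished root. A node $v$ of a rooted tree is a record if its label is the largest label on the unique path from $v$ to the root (both endpoints included). The height of a node is the number of edges on the path from it to the root. An endofunction on $[n]$ is a map $f:[n]\to[n]$; its functional graph is the directed graph on $[n]$ with edges $(i,f(i))$. The endofunction is connected if its functional graph is connected when orientations are ignored; its girth is then the number of edges of the unique directed cycle of its functional graph. -}

module Defs where

open import Data.Nat using (ℕ; zero; suc; _<_; _≤_)
open import Data.Fin using (Fin) renaming (_≤_ to _≤ᶠ_)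
open import Data.Vec using (Vec; lookup)
open import Data.List using (List; length)
open import Data.List.Membership.Propositional using (_∈_)
open import Data.List.Relation.Unary.Unique.Propositional using (Unique)
open import Data.Product using (Σ; ∃; _×_)
open import Data.Sum using (_⊎_)
open import Relation.Binary.PropositionalEquality using (_≡_; _≢_)
open import Relation.Binary.Construct.Closure.ReflexiveTransitive using (Star)
open import Function.Bundles using (_⇔_)

-- An endofunction on [n] is represented by its table of values
-- (a vector of length n), so that equality of endofunctions is ≡.
-- The label i ∈ [n] is represented by Fin n (label i ↦ i - 1,
-- an order isomorphism).
Endo : ℕ → Set
Endo n = Vec (Fin n) n

app : ∀ {n} → Endo n → Fin n → Fin n
app f i = lookup f i

iter : ∀ {n} → Endo n → ℕ → Fin n → Fin n
iter f zero    x = x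
iter f (suc m) x = app f (iter f m x)

HasCard : {A : Set} → (A → Set) → ℕ → Set
HasCard {A} P c =
  Σ (List A) λ L → Unique L × (∀ x → (x ∈ L) ⇔ P x) × length L ≡ c

-- Rooted trees on [n], in parent-pointer form: a rooted tree T with
-- root r is encoded by the map p sending each non-root vertex to its
-- neighbour on the path to the root and sending r to itself.
-- p encodes a rooted tree with root r iff p r = r and every vertex
-- reaches r by iterating p.  (This is a bijection with rooted trees.)

IsRootedTreeWithRoot : ∀ {n} → Endo n → Fin n → Set
IsRootedTreeWithRoot p r = (app p r ≡ r) × (∀ u → ∃ λ m → iter p m u ≡ r)

HeightIs : ∀ {n} → Endo n → Fin n → Fin n → ℕ → Set
HeightIs p r v h = (iter p h v ≡ r) × (∀ m → m < h → iter p m v ≢ r)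

IsRecordAtHeight : ∀ {n} → Endo n → Fin n → Fin n → ℕ → Set
IsRecordAtHeight p r v h =
  HeightIs p r v h × (∀ m → m ≤ h → iter p m v ≤ᶠ v)

TreeRecordPair : ∀ {n} → ℕ → Endo n × Fin n → Set
TreeRecordPair k (p Data.Product., v) =
  Σ _ λ r → IsRootedTreeWithRoot p r ×
    Σ ℕ λ h → suc h ≡ k × IsRecordAtHeight p r v h

Adj : ∀ {n} → Endo n → Fin n → Fin n → Set
Adj f a b = (app f a ≡ b) ⊎ (app f b ≡ a)

IsConnected : ∀ {n} → Endo n → Set
IsConnected f = ∀ a b → Star (Adj f) a b

-- the functional graph has a directed cycle with exactly k edges:
-- some x returns to itself after k steps and not before.
-- (For a connected endofunction the cycle is unique, so this says the
-- girth is k.)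
HasGirth : ∀ {n} → Endo n → ℕ → Set
HasGirth f k =
  Σ _ λ x → (0 < k) × (iter f k x ≡ x) ×
    (∀ m → 0 < m → m < k → iter f m x ≢ x)

ConnectedOfGirth : ∀ {n} → ℕ → Endo n → Set
ConnectedOfGirth k f = IsConnected f × HasGirth f k

{-# OPTIONS --safe #-}
module Submission where

-- Let v be a record at height k - 1 of a rooted tree p with root r.  Redirecting r to v
-- closes the path v, p v, ..., r into a cycle of length k; the result is connected
-- (every vertex still reaches r) and, because v is a record, v is the largest point of
-- that cycle.  Conversely a connected endofunction of girth k determines the pair:
-- v is the largest point of its cycle, r the predecessor of v on it, and making r a
-- fixed point gives back the tree.  To count, the tree-record pairs are decided by
-- enumeration, using that reachability under an endofunction of [n] is witnessed
-- within n steps (pigeonhole).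

open import Defs
open import Data.Nat using (ℕ; _≤_)
open import Data.Fin using (Fin)
open import Data.Product using (Σ; _×_)

open import Data.Nat using (zero; suc; _+_; _*_; _∸_; _<_; _%_; _/_; z≤n; s≤s; z<s; anyUpTo?; allUpTo?)
import Data.Nat.Properties as ℕ
open import Data.Nat.DivMod using (m≡m%n+[m/n]*n; m%n<n)
open import Data.Fin as Fin using (toℕ)
import Data.Fin.Properties as Fin
open import Data.Vec using (Vec; []; _∷_; lookup; _[_]≔_)
open import Data.Vec.Properties using (lookup∘update; lookup∘update′; []≔-idempotent; []≔-lookup)
import Data.Vec.Properties as Vec
open import Data.List using (List; [_]; map; filter; length; cartesianProduct; cartesianProductWith; allFin; deduplicate)
open import Data.List.Properties using (length-map)
open import Data.List.Membership.Propositional using (_∈_)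
open import Data.List.Membership.Propositional.Properties
  using (∈-map⁺; ∈-map⁻; ∈-filter⁺; ∈-filter⁻; ∈-deduplicate⁺; ∈-deduplicate⁻; ∈-cartesianProductWith⁺; ∈-cartesianProduct⁺; ∈-allFin)
open import Data.List.Relation.Unary.All as All using (All)
import Data.List.Relation.Unary.All.Properties as All
open import Data.List.Relation.Unary.AllPairs using ([]; _∷_)
open import Data.List.Relation.Unary.Any using (here)
open import Data.List.Relation.Unary.Unique.Propositional using (Unique)
open import Data.List.Relation.Unary.Unique.DecPropositional.Properties using (deduplicate-!)
open import Data.Product using (_,_; proj₁; proj₂; ∃; map₂)
import Data.Product.Properties as Product
open import Data.Sum using (inj₁; inj₂)
import Data.Sum as Sum
open import Data.Empty using (⊥-elim)
open import Function using (_∘_)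
open import Function.Bundles using (_⇔_; mk⇔; Equivalence)
open import Relation.Nullary using (yes; no; ¬?)
open import Relation.Nullary.Decidable using (Dec; map′; _×-dec_)
open import Relation.Unary using (Decidable)
open import Relation.Binary.Definitions using (DecidableEquality)
open import Relation.Binary.PropositionalEquality
  using (_≡_; _≢_; refl; sym; trans; cong; cong₂; subst; module ≡-Reasoning)
open import Relation.Binary.Construct.Closure.ReflexiveTransitive using (Star; ε; _◅_; _◅◅_; reverse)

private
  variable
    n h j k m : ℕ
    A B : Set
    f g : Endo n
    c x y : Fin n

module _ {P : A → Set} (g : A → B) (injective : ∀ {x y} → P x → P y → g x ≡ g y → x ≡ y) where

  unique-map-injectiveOn : ∀ {L} → All P L → Unique L → Unique (map g L)
  unique-map-injectiveOn All.[] [] = []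
  unique-map-injectiveOn (px All.∷ pL) (x∉L ∷ uL) =
    All.map⁺ (All.zipWith (λ (x≢y , py) → x≢y ∘ injective px py) (x∉L , pL))
      ∷ unique-map-injectiveOn pL uL

  hasCard-image : {Q : B → Set} → (∀ y → Q y ⇔ ∃ λ x → P x × g x ≡ y) → ∀ {c} → HasCard P c → HasCard Q c
  hasCard-image {Q} image (L , uL , L⇔P , |L|≡c) =
    map g L , unique-map-injectiveOn (All.tabulate (Equivalence.to (L⇔P _))) uL ,
    (λ y → mk⇔ (listed⇒Q y) (Q⇒listed y)) , trans (length-map g L) |L|≡c
    where
    listed⇒Q : ∀ y → y ∈ map g L → Q y
    listed⇒Q y y∈ with x , x∈L , refl ← ∈-map⁻ g y∈ =
      Equivalence.from (image y) (x , Equivalence.to (L⇔P x) x∈L , refl)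
    Q⇒listed : ∀ y → Q y → y ∈ map g L
    Q⇒listed y qy with x , px , refl ← Equivalence.to (image y) qy =
      ∈-map⁺ g (Equivalence.from (L⇔P x) px)

decidable⇒hasCard : {A : Set} → DecidableEquality A → (xs : List A) → (∀ x → x ∈ xs) →
                    {P : A → Set} → Decidable P → ∃ (HasCard P)
decidable⇒hasCard {A} _≟_ xs complete P? =
  length L , L , deduplicate-! _≟_ (filter P? xs) ,
  (λ x → mk⇔ (proj₂ ∘ ∈-filter⁻ P? {xs = xs} ∘ ∈-deduplicate⁻ _≟_ (filter P? xs))
             (∈-deduplicate⁺ _≟_ ∘ ∈-filter⁺ P? (complete x))) , refl
  where
  L : List A
  L = deduplicate _≟_ (filter P? xs)

allVecs : List A → ∀ m → List (Vec A m)
allVecs xs zero    = [ [] ]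
allVecs xs (suc m) = cartesianProductWith _∷_ xs (allVecs xs m)

∈-allVecs : {xs : List A} → (∀ x → x ∈ xs) → (ys : Vec A m) → ys ∈ allVecs xs m
∈-allVecs complete []       = here refl
∈-allVecs complete (y ∷ ys) = ∈-cartesianProductWith⁺ _∷_ (complete y) (∈-allVecs complete ys)

Reaches : Endo n → Fin n → Fin n → Set
Reaches f a b = ∃ λ m → iter f m a ≡ b

AgreeOutside : Endo n → Endo n → Fin n → Set
AgreeOutside f g r = ∀ y → y ≢ r → app f y ≡ app g y

OnCycleOfLength : Endo n → ℕ → Fin n → Set
OnCycleOfLength f k x = 0 < k × iter f k x ≡ x × (∀ m → 0 < m → m < k → iter f m x ≢ x)

iter-+ : ∀ (f : Endo n) m k x → iter f (m + k) x ≡ iter f m (iter f k x)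
iter-+ f zero    k x = refl
iter-+ f (suc m) k x = cong (app f) (iter-+ f m k x)

iter-comm : ∀ (f : Endo n) m k x → iter f m (iter f k x) ≡ iter f k (iter f m x)
iter-comm f m k x = begin
  iter f m (iter f k x) ≡⟨ iter-+ f m k x ⟨
  iter f (m + k) x      ≡⟨ cong (λ i → iter f i x) (ℕ.+-comm m k) ⟩
  iter f (k + m) x      ≡⟨ iter-+ f k m x ⟩
  iter f k (iter f m x) ∎
  where open ≡-Reasoning

iter-suc : ∀ (f : Endo n) m x → iter f (suc m) x ≡ iter f m (app f x)
iter-suc f zero    x = refl
iter-suc f (suc m) x = cong (app f) (iter-suc f m x)

iter-fixed : app f c ≡ c → ∀ m → iter f m c ≡ c
iter-fixed fc≡c zero    = refl
iter-fixed {f = f} fc≡c (suc m) = trans (cong (app f) (iter-fixed fc≡c m)) fc≡c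

iter-fixes-orbit : ∀ m → iter f m y ≡ y → ∀ k → iter f m (iter f k y) ≡ iter f k y
iter-fixes-orbit {f = f} {y = y} m fixed k = trans (iter-comm f m k y) (cong (iter f k) fixed)

iter-*-period : ∀ j → iter f j x ≡ x → ∀ t → iter f (t * j) x ≡ x
iter-*-period                 j period zero    = refl
iter-*-period {f = f} {x = x} j period (suc t) =
  trans (iter-+ f j (t * j) x) (trans (cong (iter f j) (iter-*-period j period t)) period)

iter-%-period : ∀ j → iter f (suc j) x ≡ x → ∀ m → iter f m x ≡ iter f (m % suc j) x
iter-%-period {f = f} {x = x} j period m = begin
  iter f m x                                          ≡⟨ cong (λ i → iter f i x) (m≡m%n+[m/n]*n m (suc j)) ⟩
  iter f (m % suc j + m / suc j * suc j) x            ≡⟨ iter-+ f (m % suc j) _ x ⟩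
  iter f (m % suc j) (iter f (m / suc j * suc j) x)   ≡⟨ cong (iter f (m % suc j)) (iter-*-period (suc j) period (m / suc j)) ⟩
  iter f (m % suc j) x                                ∎
  where open ≡-Reasoning

periodic-reaches-back : ∀ j → iter f (suc j) x ≡ x → Reaches f x y → Reaches f y x
periodic-reaches-back {f = f} {x = x} j period (m , refl) = m * suc j ∸ m , (begin
  iter f (m * suc j ∸ m) (iter f m x) ≡⟨ iter-+ f (m * suc j ∸ m) m x ⟨
  iter f (m * suc j ∸ m + m) x        ≡⟨ cong (λ i → iter f i x) (ℕ.m∸n+n≡m (ℕ.m≤m*n m (suc j))) ⟩
  iter f (m * suc j) x                ≡⟨ iter-*-period (suc j) period m ⟩
  x                                   ∎)
  where open ≡-Reasoning

onCycle-iter : OnCycleOfLength f k x → ∀ m → OnCycleOfLength f k (iter f m x)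
onCycle-iter {f = f} {suc j} {x} (0<k , closes , minimal) m =
  0<k , iter-fixes-orbit (suc j) closes m , λ i 0<i i<k fixed → minimal i 0<i i<k (x-fixed i fixed)
  where
  x-fixed : ∀ i → iter f i (iter f m x) ≡ iter f m x → iter f i x ≡ x
  x-fixed i fixed with s , back ← periodic-reaches-back j closes (m , refl) =
    subst (λ z → iter f i z ≡ z) back (iter-fixes-orbit i fixed s)

iter-agree : AgreeOutside f g c → ∀ i → (∀ m → m < i → iter f m x ≢ c) → iter f i x ≡ iter g i x
iter-agree agree zero    avoids = refl
iter-agree {g = g} agree (suc i) avoids =
  trans (agree _ (avoids i (ℕ.n<1+n i)))
        (cong (app g) (iter-agree agree i (λ m m<i → avoids m (ℕ.m<n⇒m<1+n m<i))))

reaches-redirect : AgreeOutside f g c → Reaches f x c → Reaches g x c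
reaches-redirect {f = f} {g = g} {c = c} agree (m , fᵐa≡c) = go m fᵐa≡c
  where
  go : ∀ {a} m → iter f m a ≡ c → Reaches g a c
  go {a} m fᵐa≡c with a Fin.≟ c
  ... | yes a≡c = 0 , a≡c
  go zero    a≡c      | no a≢c = ⊥-elim (a≢c a≡c)
  go {a} (suc m) fᵐ⁺¹a≡c | no a≢c
    with m′ , gᵐ′ga≡c ← go m (subst (λ b → iter f m b ≡ c) (agree a a≢c) (trans (sym (iter-suc f m a)) fᵐ⁺¹a≡c))
    = suc m′ , trans (iter-suc g m′ a) gᵐ′ga≡c

iter-repeats : ∀ (f : Endo n) x → ∃ λ m → m < n × iter f n x ≡ iter f m x
iter-repeats {n} f x with i , j , i<j , fⁱx≡fʲx ← Fin.pigeonhole (ℕ.n<1+n n) (λ i → iter f (toℕ i) x) =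
  d + toℕ i , ℕ.<-≤-trans (ℕ.+-monoʳ-< d i<j) (ℕ.≤-reflexive d+j≡n) , (begin
    iter f n x                   ≡⟨ cong (λ m → iter f m x) d+j≡n ⟨
    iter f (d + toℕ j) x         ≡⟨ iter-+ f d (toℕ j) x ⟩
    iter f d (iter f (toℕ j) x)  ≡⟨ cong (iter f d) fⁱx≡fʲx ⟨
    iter f d (iter f (toℕ i) x)  ≡⟨ iter-+ f d (toℕ i) x ⟨
    iter f (d + toℕ i) x         ∎)
  where
  open ≡-Reasoning
  d : ℕ
  d = n ∸ toℕ j
  d+j≡n : d + toℕ j ≡ n
  d+j≡n = ℕ.m∸n+n≡m (Fin.toℕ≤pred[n] j)

iter-bounded : ∀ (f : Endo n) x m → ∃ λ m′ → m′ < n × iter f m x ≡ iter f m′ x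
iter-bounded f x zero = 0 , ℕ.≤-<-trans z≤n (Fin.toℕ<n x) , refl
iter-bounded f x (suc m) with m′ , m′<n , fᵐx≡fᵐ′x ← iter-bounded f x m
  with ℕ.m≤n⇒m<n∨m≡n m′<n
... | inj₁ m′+1<n = suc m′ , m′+1<n , cong (app f) fᵐx≡fᵐ′x
... | inj₂ refl   = map₂ (map₂ (trans (cong (app f) fᵐx≡fᵐ′x))) (iter-repeats f x)

reaches? : ∀ (f : Endo n) a b → Dec (Reaches f a b)
reaches? {n} f a b = map′
  (λ (m , _ , fᵐa≡b) → m , fᵐa≡b)
  (λ (m , fᵐa≡b) → let m′ , m′<n , fᵐa≡fᵐ′a = iter-bounded f a m in m′ , m′<n , trans (sym fᵐa≡fᵐ′a) fᵐa≡b)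
  (anyUpTo? (λ m → iter f m a Fin.≟ b) n)

iter-path : ∀ (f : Endo n) m a → Star (Adj f) a (iter f m a)
iter-path f zero    a = ε
iter-path f (suc m) a = iter-path f m a ◅◅ (inj₁ refl ◅ ε)

reaches-common⇒connected : (∀ a → Reaches f a c) → IsConnected f
reaches-common⇒connected {f = f} reach a b = path a ◅◅ reverse Sum.swap (path b)
  where
  path : ∀ a → Star (Adj f) a _
  path a = let m , fᵐa≡c = reach a in subst (Star (Adj f) a) fᵐa≡c (iter-path f m a)

connected⇒reaches-periodic : IsConnected f → ∀ j → iter f (suc j) c ≡ c → ∀ a → Reaches f a c
connected⇒reaches-periodic {f = f} {c = c} connected j period a = back (connected a c) (0 , refl)
  where
  step : ∀ {a b} → Adj f a b → Reaches f b c → Reaches f a c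
  step {a} (inj₁ refl) (m , fᵐb≡c)     = suc m , trans (iter-suc f m a) fᵐb≡c
  step     (inj₂ refl) (zero , refl)   = j , trans (sym (iter-suc f j c)) period
  step     (inj₂ refl) (suc m , fᵐ⁺¹b≡c) = m , trans (sym (iter-suc f m _)) fᵐ⁺¹b≡c
  back : ∀ {a b} → Star (Adj f) a b → Reaches f b c → Reaches f a c
  back ε            = λ reach → reach
  back (adj ◅ path) = step adj ∘ back path

isRootedTreeWithRoot? : ∀ (p : Endo n) r → Dec (IsRootedTreeWithRoot p r)
isRootedTreeWithRoot? p r = (app p r Fin.≟ r) ×-dec Fin.all? (λ u → reaches? p u r)

heightIs? : ∀ (p : Endo n) r v h → Dec (HeightIs p r v h)
heightIs? p r v h =
  (iter p h v Fin.≟ r) ×-dec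
  map′ (λ avoids m → avoids {m}) (λ avoids {m} → avoids m) (allUpTo? (λ m → ¬? (iter p m v Fin.≟ r)) h)

isRecordAtHeight? : ∀ (p : Endo n) r v h → Dec (IsRecordAtHeight p r v h)
isRecordAtHeight? p r v h =
  heightIs? p r v h ×-dec
  map′ (λ below m m≤h → below (s≤s m≤h)) (λ below {m} m<1+h → below m (ℕ.≤-pred m<1+h))
       (allUpTo? (λ m → iter p m v Fin.≤? v) (suc h))

treeRecordPair? : ∀ k (pv : Endo n × Fin n) → Dec (TreeRecordPair k pv)
treeRecordPair? zero    _       = no λ { (_ , _ , _ , () , _) }
treeRecordPair? (suc h) (p , v) = map′
  (λ (r , tree , isRec) → r , tree , h , refl , isRec)
  (λ { (r , tree , .h , refl , isRec) → r , tree , isRec })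
  (Fin.any? λ r → isRootedTreeWithRoot? p r ×-dec isRecordAtHeight? p r v h)

argmax-upTo : ∀ (g : ℕ → Fin n) j → ∃ λ a → ∀ m → m ≤ j → g m Fin.≤ g a
argmax-upTo g zero = 0 , λ { _ z≤n → Fin.≤-refl }
argmax-upTo g (suc j) with a , max ← argmax-upTo g j | Fin.≤-total (g (suc j)) (g a)
... | inj₁ below = a , λ m m≤j+1 →
  Sum.[ (λ m≤j → max m (ℕ.≤-pred m≤j)) , (λ { refl → below }) ] (ℕ.m≤n⇒m<n∨m≡n m≤j+1)
... | inj₂ above = suc j , λ m m≤j+1 →
  Sum.[ (λ m≤j → Fin.≤-trans (max m (ℕ.≤-pred m≤j)) above) , (λ { refl → Fin.≤-refl }) ] (ℕ.m≤n⇒m<n∨m≡n m≤j+1)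

[]≔-undo : ∀ (xs : Vec A n) i {x y} → lookup xs i ≡ y → (xs [ i ]≔ x) [ i ]≔ y ≡ xs
[]≔-undo xs i {x} {y} xsᵢ≡y = begin
  (xs [ i ]≔ x) [ i ]≔ y                ≡⟨ []≔-idempotent xs i ⟩
  xs [ i ]≔ y                           ≡⟨ cong (xs [ i ]≔_) xsᵢ≡y ⟨
  xs [ i ]≔ lookup xs i        ≡⟨ []≔-lookup xs i ⟩
  xs                                    ∎
  where open ≡-Reasoning

allEndoPairs : ∀ n → List (Endo n × Fin n)
allEndoPairs n = cartesianProduct (allVecs (allFin n) n) (allFin n)

∈-allEndoPairs : ∀ (pv : Endo n × Fin n) → pv ∈ allEndoPairs n
∈-allEndoPairs (p , v) = ∈-cartesianProduct⁺ (∈-allVecs ∈-allFin p) (∈-allFin v)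

-- For k = 0 the truncated k ∸ 1 is harmless: TreeRecordPair 0 is empty.
closePath : ℕ → Endo n × Fin n → Endo n
closePath k (p , v) = p [ iter p (k ∸ 1) v ]≔ v

module ClosedPath {p : Endo n} {r v : Fin n} {h : ℕ}
                  (tree : IsRootedTreeWithRoot p r) (isRec : IsRecordAtHeight p r v h) where

  private
    root-fixed : app p r ≡ r
    root-fixed = proj₁ tree
    reaches-root : ∀ u → Reaches p u r
    reaches-root = proj₂ tree
    avoids-root : ∀ m → m < h → iter p m v ≢ r
    avoids-root = proj₂ (proj₁ isRec)

  closed : Endo n
  closed = p [ r ]≔ v

  closed-root : app closed r ≡ v
  closed-root = lookup∘update r p v

  p-agrees : AgreeOutside p closed r
  p-agrees y y≢r = sym (lookup∘update′ y≢r p v)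

  path-agrees : ∀ i → i ≤ h → iter p i v ≡ iter closed i v
  path-agrees i i≤h = iter-agree p-agrees i (λ m m<i → avoids-root m (ℕ.<-≤-trans m<i i≤h))

  path-ends-at-root : iter closed h v ≡ r
  path-ends-at-root = trans (sym (path-agrees h ℕ.≤-refl)) (proj₁ (proj₁ isRec))

  closes : iter closed (suc h) v ≡ v
  closes = trans (cong (app closed) path-ends-at-root) closed-root

  on-cycle : OnCycleOfLength closed (suc h) v
  on-cycle = z<s , closes , minimal
    where
    -- An earlier return to v makes v periodic under p, so v would be the root.
    minimal : ∀ m → 0 < m → m < suc h → iter closed m v ≢ v
    minimal (suc m) _ (s≤s m<h) fᵐ⁺¹v≡v
      with s , pˢr≡v ← periodic-reaches-back m (trans (path-agrees (suc m) m<h) fᵐ⁺¹v≡v) (reaches-root v)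
      = avoids-root 0 (ℕ.≤-<-trans z≤n m<h) (trans (sym pˢr≡v) (iter-fixed root-fixed s))

  connected : IsConnected closed
  connected = reaches-common⇒connected (λ u → reaches-redirect {g = closed} p-agrees (reaches-root u))

  -- A periodic point reaches r, so it is reached from r and lies on the path from v to r.
  periodic≤v : ∀ j x → iter closed (suc j) x ≡ x → x Fin.≤ v
  periodic≤v j x period
    with s , fˢr≡x ← periodic-reaches-back j period (reaches-redirect p-agrees (reaches-root x))
    = subst (Fin._≤ v) pᵗv≡x (proj₂ isRec t t≤h)
    where
    t : ℕ
    t = (s + h) % suc h
    t≤h : t ≤ h
    t≤h = ℕ.≤-pred (m%n<n (s + h) (suc h))
    open ≡-Reasoning
    pᵗv≡x : iter p t v ≡ x
    pᵗv≡x = begin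
      iter p t v            ≡⟨ path-agrees t t≤h ⟩
      iter closed t v            ≡⟨ iter-%-period h closes (s + h) ⟨
      iter closed (s + h) v      ≡⟨ iter-+ closed s h v ⟩
      iter closed s (iter closed h v) ≡⟨ cong (iter closed s) path-ends-at-root ⟩
      iter closed s r            ≡⟨ fˢr≡x ⟩
      x                     ∎

closePath-connectedOfGirth : ∀ k {pv : Endo n × Fin n} → TreeRecordPair k pv → ConnectedOfGirth k (closePath k pv)
closePath-connectedOfGirth _ {_ , v} (_ , tree , _ , refl , isRec@((refl , _) , _)) = connected , v , on-cycle
  where open ClosedPath tree isRec

closePath-injective : ∀ k {pv pw : Endo n × Fin n} → TreeRecordPair k pv → TreeRecordPair k pw →
                      closePath k pv ≡ closePath k pw → pv ≡ pw
closePath-injective _ {p , v} {p′ , v′} (r , tree , h , refl , isRec@((refl , _) , _))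
                    (r′ , tree′ , .h , refl , isRec′@((refl , _) , _)) f≡f′ = cong₂ _,_ p≡p′ v≡v′
  where
  module C  = ClosedPath tree isRec
  module C′ = ClosedPath tree′ isRec′
  v≡v′ : v ≡ v′
  v≡v′ = Fin.≤-antisym (C′.periodic≤v h v (subst (λ g → iter g (suc h) v ≡ v) f≡f′ C.closes))
                       (C.periodic≤v h v′ (subst (λ g → iter g (suc h) v′ ≡ v′) (sym f≡f′) C′.closes))
  r≡r′ : r ≡ r′
  r≡r′ = trans (sym C.path-ends-at-root) (trans (cong₂ (λ g w → iter g h w) f≡f′ v≡v′) C′.path-ends-at-root)
  open ≡-Reasoning
  p≡p′ : p ≡ p′
  p≡p′ = begin
    p                     ≡⟨ []≔-undo p r (proj₁ tree) ⟨
    C.closed [ r ]≔ r     ≡⟨ cong₂ (λ g s → g [ s ]≔ s) f≡f′ r≡r′ ⟩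
    C′.closed [ r′ ]≔ r′  ≡⟨ []≔-undo p′ r′ (proj₁ tree′) ⟩
    p′                    ∎

module OpenedCycle {f : Endo n} (connected : IsConnected f) {h x} (on-cycle : OnCycleOfLength f (suc h) x) where

  argmax-on-cycle : ∃ λ a → ∀ m → m ≤ h → iter f m x Fin.≤ iter f a x
  argmax-on-cycle = argmax-upTo (λ m → iter f m x) h

  v : Fin n
  v = iter f (proj₁ argmax-on-cycle) x

  v-max : ∀ m → iter f m v Fin.≤ v
  v-max m = subst (Fin._≤ v) (sym fᵐv≡fᵗx) (proj₂ argmax-on-cycle t (ℕ.≤-pred (m%n<n (m + a) (suc h))))
    where
    a t : ℕ
    a = proj₁ argmax-on-cycle
    t = (m + a) % suc h
    fᵐv≡fᵗx : iter f m v ≡ iter f t x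
    fᵐv≡fᵗx = trans (sym (iter-+ f m a x)) (iter-%-period h (proj₁ (proj₂ on-cycle)) (m + a))

  v-on-cycle : OnCycleOfLength f (suc h) v
  v-on-cycle = onCycle-iter on-cycle (proj₁ argmax-on-cycle)

  r : Fin n
  r = iter f h v

  f-root : app f r ≡ v
  f-root = proj₁ (proj₂ v-on-cycle)

  p : Endo n
  p = f [ r ]≔ r

  f-agrees : AgreeOutside f p r
  f-agrees y y≢r = sym (lookup∘update′ y≢r f r)

  avoids-root : ∀ m → m < h → iter f m v ≢ r
  avoids-root m m<h fᵐv≡r = proj₂ (proj₂ v-on-cycle) (suc m) z<s (s≤s m<h) (trans (cong (app f) fᵐv≡r) f-root)

  path-agrees : ∀ i → i ≤ h → iter f i v ≡ iter p i v
  path-agrees i i≤h = iter-agree f-agrees i (λ m m<i → avoids-root m (ℕ.<-≤-trans m<i i≤h))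

  tree : IsRootedTreeWithRoot p r
  tree = lookup∘update r f r , λ u → reaches-redirect {f = f} {g = p} f-agrees (reaches-r u)
    where
    reaches-r : ∀ u → Reaches f u r
    reaches-r = connected⇒reaches-periodic connected h (proj₁ (proj₂ (onCycle-iter v-on-cycle h)))

  isRec : IsRecordAtHeight p r v h
  isRec = (sym (path-agrees h ℕ.≤-refl) ,
           λ m m<h pᵐv≡r → avoids-root m m<h (trans (path-agrees m (ℕ.<⇒≤ m<h)) pᵐv≡r)) ,
          λ m m≤h → subst (Fin._≤ v) (path-agrees m m≤h) (v-max m)

  closePath≡f : closePath (suc h) (p , v) ≡ f
  closePath≡f = trans (cong (p [_]≔ v) (sym (path-agrees h ℕ.≤-refl))) ([]≔-undo f r f-root)

closePath-image : ∀ k (f : Endo n) → ConnectedOfGirth k f ⇔ ∃ λ pv → TreeRecordPair k pv × closePath k pv ≡ f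
closePath-image k f = mk⇔ opened closed
  where
  opened : ConnectedOfGirth k f → ∃ λ pv → TreeRecordPair k pv × closePath k pv ≡ f
  opened (connected , _ , on-cycle@(z<s , _)) = (p , v) , (r , tree , _ , refl , isRec) , closePath≡f
    where open OpenedCycle connected on-cycle
  closed : ∃ (λ pv → TreeRecordPair k pv × closePath k pv ≡ f) → ConnectedOfGirth k f
  closed (_ , pair , refl) = closePath-connectedOfGirth k pair

theorem1p1 : (n k : ℕ) → k ≤ n →
    Σ ℕ λ c → HasCard (TreeRecordPair {n} k) c × HasCard (ConnectedOfGirth {n} k) c
theorem1p1 n k _ =
  let c , trees = decidable⇒hasCard (Product.≡-dec (Vec.≡-dec Fin._≟_) Fin._≟_)
                                    (allEndoPairs n) ∈-allEndoPairs (treeRecordPair? k)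
  in c , trees , hasCard-image (closePath k) (closePath-injective k) (closePath-image k) trees
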